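{- Let $\mathcal{S}$ be a single-set cubical $\omega$-category and let $i,j\in\mathbb{N}_+$, $\alpha\in\{ -,+\}$. (i) If $x\in\mathcal{S}^{j+1}$, then $\delta_i^\alpha\tilde s_jx=\tilde s_j\delta_{j+1}^\alpha x$ if $i=j$; $\delta_i^\alpha\tilde s_jx=\tilde s_j\delta_j^\alpha x$ if $i=j+1$; and $\delta_i^\alpha\tilde s_jx=\tilde s_j\delta_i^\alpha x$ otherwise. (ii) If $x,y\in\mathcal{S}^{i+1}$ and $\Delta_j(x,y)$, then $\tilde s_i(x\circ_jy)=\tilde s_ix\circ_{i+1}\tilde s_iy$ if $j=i$; $\tilde s_i(x\circ_jy)=\tilde s_ix\circ_i\tilde s_iy$ if $j=i+1$; and $\tilde s_i(x\circ_jy)=\tilde s_ix\circ_j\tilde s_iy$ otherwise. (iii) $\tilde s_ix=x$ if $x\in\mathcal{S}^{i,i+1}$. (iv) If $|i-j|\geq2$, $x\in\mathcal{S}^{i,j+1}$, $y\in\mathcal{S}^{i+1,j}$ and $z\in\mathcal{S}^{i+1,j+1}$, then $s_i\tilde s_jx=\tilde s_js_ix$, $\tilde s_is_jy=s_j\tilde s_iy$ and $\tilde s_i\tilde s_jz=\tilde s_j\tilde s_iz$. (v) $\tilde s_i\tilde s_{i+1}\tilde s_ix=\tilde s_{i+1}\tilde s_i\tilde s_{i+1}x$ if $x\in\mathcal{S}^{i+1,i+2}$.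
   Context: A single-set category is a set $\mathcal{S}$ with $\delta^-,\delta^+:\mathcal{S}\to\mathcal{S}$ and $\odot:\mathcal{S}\times\mathcal{S}\to\mathcal{P}(\mathcal{S})$ (extended to subsets by unions) with $\{x\}\odot(y\odot z)=(x\odot y)\odot\{z\}$, $x\odot\delta^+x=\{x\}=\delta^-x\odot x$, $x\odot y\neq\varnothing\iff\delta^+x=\delta^-y$, and $|x\odot y|\leq1$; $\Delta(x,y)$ means $x\odot y\neq\varnothing$ and $x\circ y$ is its element. A single-set cubical $\omega$-category is a set $\mathcal{S}$ with, for each $i\in\mathbb{N}_+$, a single-set category structure $(\delta_i^\pm,\odot_i)$ (with $\Delta_i,\circ_i$) and maps $s_i,\tilde s_i:\mathcal{S}\to\mathcal{S}$; $\mathcal{S}^i$ is the set of fixed points of $\delta_i^-$ (equivalently $\delta_i^+$), $\mathcal{S}^{i,j}=\mathcal{S}^i\cap\mathcal{S}^j$. Axioms (all $i,j$, $\alpha,\beta$): $\delta_i^\alpha\delta_j^\beta=\delta_j^\beta\delta_i^\alpha$ ($i\neq j$); $\delta_i^\alpha(x\circ_jy)=\delta_i^\alpha x\circ_j\delta_i^\alpha y$ ($i\neq j$, $\Delta_j(x,y)$); $(w\circ_ix)\circ_j(y\circ_iz)=(w\circ_jy)\circ_i(x\circ_jz)$ ($i\neq j$, $\Delta_i(w,x),\Delta_i(y,z),\Delta_j(w,y),\Delta_j(x,z)$); $s_i(\mathcal{S}^i)\subseteq\mathcal{S}^{i+1}$, $\tilde s_i(\mathcal{S}^{i+1})\subseteq\mathcal{S}^i$;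 $\tilde s_is_ix=x$ ($x\in\mathcal{S}^i$), $s_i\tilde s_iy=y$ ($y\in\mathcal{S}^{i+1}$); for $x\in\mathcal{S}^j$: $\delta_j^\alpha s_jx=s_j\delta_{j+1}^\alpha x$, $\delta_i^\alpha s_jx=s_j\delta_i^\alpha x$ ($i\neq j,j+1$); for $x,y\in\mathcal{S}^i$: $s_i(x\circ_{i+1}y)=s_ix\circ_is_iy$ ($\Delta_{i+1}(x,y)$), $s_i(x\circ_jy)=s_ix\circ_js_iy$ ($j\neq i,i+1$, $\Delta_j(x,y)$); $s_ix=x$ on $\mathcal{S}^{i,i+1}$; $s_is_jx=s_js_ix$ ($|i-j|\geq2$, $x\in\mathcal{S}^{i,j}$); every $x$ lies in $\mathcal{S}^i$ for all sufficiently large $i$. -}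

module Defs where

open import Data.Nat using (ℕ; suc; _+_; _≤_)
open import Data.Product using (Σ; _×_; ∃)
open import Data.Sum using (_⊎_)
open import Relation.Binary.PropositionalEquality using (_≡_; _≢_)
open import Function.Bundles using (_⇔_)

data Sign : Set where
  minus plus : Sign

-- Single-set category structure on a carrier S.
-- The multivalued composition ⊙ : S × S → 𝒫(S) is represented by its
-- membership relation:  Comp x y w  means  w ∈ x ⊙ y.
record IsSingleSetCategory (S : Set) : Set₁ where
  field
    δ    : Sign → S → S
    Comp : S → S → S → Set

  Δ : S → S → Set
  Δ x y = ∃ λ w → Comp x y w

  field
    assoc : ∀ x y z w →
      (∃ λ u → Comp y z u × Comp x u w) ⇔ (∃ λ u → Comp x y u × Comp u z w)
    unitʳ : ∀ x w → Comp x (δ plus x) w ⇔ (w ≡ x)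
    unitˡ : ∀ x w → Comp (δ minus x) x w ⇔ (w ≡ x)
    defined : ∀ x y → Δ x y ⇔ (δ plus x ≡ δ minus y)
    functional : ∀ x y w w′ → Comp x y w → Comp x y w′ → w ≡ w′

Far : ℕ → ℕ → Set
Far i j = (2 + i ≤ j) ⊎ (2 + j ≤ i)

-- Indices i ∈ ℕ₊ are encoded by ℕ with a
-- shift by one (n : ℕ stands for n+1); all index conditions involved
-- (i ≠ j, i = j+1, |i-j| ≥ 2, ...) are shift invariant.
record CubicalωCat : Set₁ where
  field
    Carrier : Set
    cat     : ℕ → IsSingleSetCategory Carrier
    s       : ℕ → Carrier → Carrier
    s̃       : ℕ → Carrier → Carrier

  δ : ℕ → Sign → Carrier → Carrier
  δ i = IsSingleSetCategory.δ (cat i)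

  Comp : ℕ → Carrier → Carrier → Carrier → Set
  Comp i = IsSingleSetCategory.Comp (cat i)

  Δ : ℕ → Carrier → Carrier → Set
  Δ i = IsSingleSetCategory.Δ (cat i)

  Cell : ℕ → Carrier → Set
  Cell i x = δ i minus x ≡ x

  Cell₂ : ℕ → ℕ → Carrier → Set
  Cell₂ i j x = Cell i x × Cell j x

  field
    δ-comm : ∀ i j α β x → i ≢ j → δ i α (δ j β x) ≡ δ j β (δ i α x)
    δ-comp : ∀ i j α x y w → i ≢ j → Comp j x y w →
               Comp j (δ i α x) (δ i α y) (δ i α w)
    interchange : ∀ i j w x y z a b c d → i ≢ j →
               Comp i w x a → Comp i y z b → Comp j w y c → Comp j x z d →
               Σ Carrier λ e → Comp j a b e × Comp i c d e
    s-cell  : ∀ i x → Cell i x → Cell (suc i) (s i x)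
    s̃-cell  : ∀ i x → Cell (suc i) x → Cell i (s̃ i x)
    s̃s      : ∀ i x → Cell i x → s̃ i (s i x) ≡ x
    ss̃      : ∀ i y → Cell (suc i) y → s i (s̃ i y) ≡ y
    δ-s-same  : ∀ j α x → Cell j x → δ j α (s j x) ≡ s j (δ (suc j) α x)
    δ-s-other : ∀ i j α x → Cell j x → i ≢ j → i ≢ suc j →
                  δ i α (s j x) ≡ s j (δ i α x)
    s-comp-next : ∀ i x y w → Cell i x → Cell i y → Comp (suc i) x y w →
                  Comp i (s i x) (s i y) (s i w)
    s-comp-other : ∀ i j x y w → Cell i x → Cell i y → j ≢ i → j ≢ suc i →
                  Comp j x y w → Comp j (s i x) (s i y) (s i w)
    s-degenerate : ∀ i x → Cell₂ i (suc i) x → s i x ≡ x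
    s-s-comm : ∀ i j x → Far i j → Cell₂ i j x → s i (s j x) ≡ s j (s i x)
    eventually : ∀ x → ∃ λ n → ∀ i → n ≤ i → Cell i x

-- On cells, sᵢ : 𝒮ⁱ → 𝒮ⁱ⁺¹ is a bijection with inverse s̃ᵢ, so every
-- axiom about sᵢ transports to s̃ᵢ.  The only tool is uniqueness of preimages:
-- if y ∈ 𝒮ⁱ and sᵢ y = x then s̃ᵢ x = y.  Composites are transported by first
-- composing s̃ᵢx and s̃ᵢy (their boundaries match by (i)) and then identifying
-- sᵢ of that composite with x ∘ⱼ y by uniqueness of composites.
module Submission where

open import Defs
open import Data.Nat using (ℕ; suc)
open import Data.Nat.Properties
  using (<⇒≢; >⇒≢; ≤-trans; n≤1+n; m<n⇒m≤1+n; 1+n≢n; suc-injective)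
open import Data.Product using (_×_; _,_)
open import Data.Sum using (inj₁; inj₂)
open import Function using (_∘_)
open import Function.Bundles using (Equivalence)
open import Relation.Binary.PropositionalEquality

Far-sym : ∀ {i j} → Far i j → Far j i
Far-sym (inj₁ p) = inj₂ p
Far-sym (inj₂ p) = inj₁ p

Far⇒≢ : ∀ {i j} → Far i j → i ≢ j
Far⇒≢ (inj₁ p) = <⇒≢ (≤-trans (n≤1+n _) p)
Far⇒≢ (inj₂ p) = >⇒≢ (≤-trans (n≤1+n _) p)

Far⇒≢suc : ∀ {i j} → Far i j → i ≢ suc j
Far⇒≢suc (inj₁ p) = <⇒≢ (m<n⇒m≤1+n p)
Far⇒≢suc (inj₂ p) = >⇒≢ p

module SingleSetCategoryProperties {S : Set} (C : IsSingleSetCategory S) where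
  open IsSingleSetCategory C
  open Equivalence

  identity-comp : ∀ {x} → δ minus x ≡ x → Comp x x x
  identity-comp {x} x-id = subst (λ u → Comp u x x) x-id (from (unitˡ x x) refl)

  identity-δ : ∀ {x} α → δ minus x ≡ x → δ α x ≡ x
  identity-δ minus x-id = x-id
  identity-δ {x} plus x-id = begin
    δ plus x            ≡⟨ cong (δ plus) (sym x-id) ⟩
    δ plus (δ minus x)  ≡⟨ to (defined (δ minus x) x) (x , from (unitˡ x x) refl) ⟩
    δ minus x           ≡⟨ x-id ⟩
    x                   ∎
    where open ≡-Reasoning

  comp-identities : ∀ {x y w} → δ minus x ≡ x → δ minus y ≡ y → Comp x y w →
                    x ≡ y × w ≡ x
  comp-identities {x} {y} {w} x-id y-id xy↦w = x≡y , w≡x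
    where
    x≡y : x ≡ y
    x≡y = trans (sym (identity-δ plus x-id)) (trans (to (defined x y) (w , xy↦w)) y-id)
    w≡x : w ≡ x
    w≡x = to (unitʳ x w)
            (subst (λ u → Comp x u w) (sym (trans (identity-δ plus x-id) x≡y)) xy↦w)

module CubicalωCatProperties (𝒮 : CubicalωCat) where
  open CubicalωCat 𝒮
  open Equivalence
  module Cat = SingleSetCategoryProperties
  open ≡-Reasoning

  Cell-δ : ∀ {i j} α {x} → i ≢ j → Cell j x → Cell j (δ i α x)
  Cell-δ {i} {j} α {x} i≢j x-cell =
    trans (δ-comm j i minus α x (≢-sym i≢j)) (cong (δ i α) x-cell)

  Cell-comp : ∀ {i j x y w} → i ≢ j → Cell i x → Cell i y → Comp j x y w → Cell i w
  Cell-comp {i} {j} {x} {y} {w} i≢j x-cell y-cell xy↦w =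
    sym (IsSingleSetCategory.functional (cat j) x y w _ xy↦w
          (subst₂ (λ a b → Comp j a b (δ i minus w)) x-cell y-cell
            (δ-comp i j minus x y w i≢j xy↦w)))

  Cell-s : ∀ {k i x} → k ≢ i → k ≢ suc i → Cell i x → Cell k x → Cell k (s i x)
  Cell-s {k} {i} {x} k≢i k≢si x-cellᵢ x-cellₖ =
    trans (δ-s-other k i minus x x-cellᵢ k≢i k≢si) (cong (s i) x-cellₖ)

  s̃-unique : ∀ {i x y} → Cell i y → s i y ≡ x → s̃ i x ≡ y
  s̃-unique {i} y-cell refl = s̃s i _ y-cell

  δ-s̃-same : ∀ {j} α {x} → Cell (suc j) x → δ j α (s̃ j x) ≡ s̃ j (δ (suc j) α x)
  δ-s̃-same {j} α {x} x-cell = begin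
    δ j α (s̃ j x)           ≡⟨ Cat.identity-δ (cat j) α (s̃-cell j x x-cell) ⟩
    s̃ j x                   ≡⟨ cong (s̃ j) (sym (Cat.identity-δ (cat (suc j)) α x-cell)) ⟩
    s̃ j (δ (suc j) α x)     ∎

  δ-s̃-next : ∀ {j} α {x} → Cell (suc j) x → δ (suc j) α (s̃ j x) ≡ s̃ j (δ j α x)
  δ-s̃-next {j} α {x} x-cell = sym (s̃-unique (Cell-δ α (1+n≢n {j}) y-cell) (begin
    s j (δ (suc j) α y)  ≡⟨ sym (δ-s-same j α y y-cell) ⟩
    δ j α (s j y)        ≡⟨ cong (δ j α) (ss̃ j x x-cell) ⟩
    δ j α x              ∎))
    where
    y : Carrier
    y = s̃ j x
    y-cell : Cell j y
    y-cell = s̃-cell j x x-cell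

  δ-s̃-other : ∀ {i j} α {x} → i ≢ j → i ≢ suc j → Cell (suc j) x →
               δ i α (s̃ j x) ≡ s̃ j (δ i α x)
  δ-s̃-other {i} {j} α {x} i≢j i≢sj x-cell = sym (s̃-unique (Cell-δ α i≢j y-cell) (begin
    s j (δ i α y)  ≡⟨ sym (δ-s-other i j α y y-cell i≢j i≢sj) ⟩
    δ i α (s j y)  ≡⟨ cong (δ i α) (ss̃ j x x-cell) ⟩
    δ i α x        ∎))
    where
    y : Carrier
    y = s̃ j x
    y-cell : Cell j y
    y-cell = s̃-cell j x x-cell

  Cell-s̃ : ∀ {k i x} → k ≢ i → k ≢ suc i → Cell (suc i) x → Cell k x → Cell k (s̃ i x)
  Cell-s̃ k≢i k≢si x-cellᵢ x-cellₖ =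
    trans (δ-s̃-other minus k≢i k≢si x-cellᵢ) (cong (s̃ _) x-cellₖ)

  s̃-comp : ∀ {i j k x y w} → i ≢ k →
           (∀ α {z} → Cell (suc i) z → δ k α (s̃ i z) ≡ s̃ i (δ j α z)) →
           (∀ {a b c} → Cell i a → Cell i b → Comp k a b c → Comp j (s i a) (s i b) (s i c)) →
           Cell (suc i) x → Cell (suc i) y → Comp j x y w → Comp k (s̃ i x) (s̃ i y) (s̃ i w)
  s̃-comp {i} {j} {k} {x} {y} {w} i≢k δ-s̃ s-comp x-cell y-cell xy↦w =
    finish (from (IsSingleSetCategory.defined (cat k) (s̃ i x) (s̃ i y)) boundaries-match)
    where
    x′-cell : Cell i (s̃ i x)
    x′-cell = s̃-cell i x x-cell
    y′-cell : Cell i (s̃ i y)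
    y′-cell = s̃-cell i y y-cell

    boundaries-match : δ k plus (s̃ i x) ≡ δ k minus (s̃ i y)
    boundaries-match = begin
      δ k plus (s̃ i x)    ≡⟨ δ-s̃ plus x-cell ⟩
      s̃ i (δ j plus x)    ≡⟨ cong (s̃ i) (to (IsSingleSetCategory.defined (cat j) x y) (w , xy↦w)) ⟩
      s̃ i (δ j minus y)   ≡⟨ sym (δ-s̃ minus y-cell) ⟩
      δ k minus (s̃ i y)   ∎

    finish : Δ k (s̃ i x) (s̃ i y) → Comp k (s̃ i x) (s̃ i y) (s̃ i w)
    finish (c , x′y′↦c) = subst (Comp k _ _) (sym (s̃-unique c-cell s-c≡w)) x′y′↦c
      where
      c-cell : Cell i c
      c-cell = Cell-comp i≢k x′-cell y′-cell x′y′↦c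
      s-c≡w : s i c ≡ w
      s-c≡w = IsSingleSetCategory.functional (cat j) x y _ w
                (subst₂ (λ a b → Comp j a b (s i c)) (ss̃ i x x-cell) (ss̃ i y y-cell)
                  (s-comp x′-cell y′-cell x′y′↦c))
                xy↦w

  s̃-comp-same : ∀ {i x y w} → Cell (suc i) x → Cell (suc i) y → Comp i x y w →
                Comp (suc i) (s̃ i x) (s̃ i y) (s̃ i w)
  s̃-comp-same {i} = s̃-comp (≢-sym (1+n≢n {i})) δ-s̃-next
                      (λ a-cell b-cell → s-comp-next i _ _ _ a-cell b-cell)

  -- Both cells are identities for ∘ᵢ₊₁, so the composite is trivial.
  s̃-comp-next : ∀ {i x y w} → Cell (suc i) x → Cell (suc i) y → Comp (suc i) x y w →
                Comp i (s̃ i x) (s̃ i y) (s̃ i w)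
  s̃-comp-next {i} x-cell y-cell xy↦w
    with Cat.comp-identities (cat (suc i)) x-cell y-cell xy↦w
  ... | refl , refl = Cat.identity-comp (cat i) (s̃-cell i _ x-cell)

  s̃-comp-other : ∀ {i j x y w} → j ≢ i → j ≢ suc i →
                 Cell (suc i) x → Cell (suc i) y → Comp j x y w →
                 Comp j (s̃ i x) (s̃ i y) (s̃ i w)
  s̃-comp-other {i} {j} j≢i j≢si = s̃-comp (≢-sym j≢i)
    (λ α → δ-s̃-other α j≢i j≢si)
    (λ a-cell b-cell → s-comp-other i j _ _ _ a-cell b-cell j≢i j≢si)

  s̃-degenerate : ∀ {i x} → Cell₂ i (suc i) x → s̃ i x ≡ x
  s̃-degenerate {i} {x} x-cells@(x-cellᵢ , _) = s̃-unique x-cellᵢ (s-degenerate i x x-cells)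

  module _ {i j} (far : Far i j) where
    private
      i≢j : i ≢ j
      i≢j = Far⇒≢ far
      i≢sj : i ≢ suc j
      i≢sj = Far⇒≢suc far
      j≢i : j ≢ i
      j≢i = Far⇒≢ (Far-sym far)
      j≢si : j ≢ suc i
      j≢si = Far⇒≢suc (Far-sym far)

    s-s̃-comm : ∀ {x} → Cell₂ i (suc j) x → s i (s̃ j x) ≡ s̃ j (s i x)
    s-s̃-comm {x} (x-cellᵢ , x-cellⱼ) =
      sym (s̃-unique (Cell-s j≢i j≢si y-cellᵢ y-cellⱼ) (begin
        s j (s i y)  ≡⟨ s-s-comm j i y (Far-sym far) (y-cellⱼ , y-cellᵢ) ⟩
        s i (s j y)  ≡⟨ cong (s i) (ss̃ j x x-cellⱼ) ⟩
        s i x        ∎))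
      where
      y : Carrier
      y = s̃ j x
      y-cellⱼ : Cell j y
      y-cellⱼ = s̃-cell j x x-cellⱼ
      y-cellᵢ : Cell i y
      y-cellᵢ = Cell-s̃ i≢j i≢sj x-cellⱼ x-cellᵢ

    s̃-s-comm : ∀ {y} → Cell₂ (suc i) j y → s̃ i (s j y) ≡ s j (s̃ i y)
    s̃-s-comm {y} (y-cellᵢ , y-cellⱼ) =
      s̃-unique (Cell-s i≢j i≢sj u-cellⱼ u-cellᵢ) (begin
        s i (s j u)  ≡⟨ s-s-comm i j u far (u-cellᵢ , u-cellⱼ) ⟩
        s j (s i u)  ≡⟨ cong (s j) (ss̃ i y y-cellᵢ) ⟩
        s j y        ∎)
      where
      u : Carrier
      u = s̃ i y
      u-cellᵢ : Cell i u
      u-cellᵢ = s̃-cell i y y-cellᵢ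
      u-cellⱼ : Cell j u
      u-cellⱼ = Cell-s̃ j≢i j≢si y-cellᵢ y-cellⱼ

    s̃-s̃-comm : ∀ {z} → Cell₂ (suc i) (suc j) z → s̃ i (s̃ j z) ≡ s̃ j (s̃ i z)
    s̃-s̃-comm {z} (z-cellᵢ , z-cellⱼ) =
      sym (s̃-unique (Cell-s̃ j≢i j≢si u-cellᵢ u-cellⱼ) (begin
        s j (s̃ i u)   ≡⟨ sym (s̃-s-comm (u-cellᵢ , u-cellⱼ)) ⟩
        s̃ i (s j u)   ≡⟨ cong (s̃ i) (ss̃ j z z-cellⱼ) ⟩
        s̃ i z         ∎))
      where
      u : Carrier
      u = s̃ j z
      u-cellⱼ : Cell j u
      u-cellⱼ = s̃-cell j z z-cellⱼ
      u-cellᵢ : Cell (suc i) u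
      u-cellᵢ = Cell-s̃ (≢-sym j≢si) (i≢j ∘ suc-injective) z-cellⱼ z-cellᵢ

  -- Both sides collapse to s̃ᵢ₊₁ (s̃ᵢ x) by degeneracy.
  s̃-braid : ∀ {i x} → Cell₂ (suc i) (suc (suc i)) x →
            s̃ i (s̃ (suc i) (s̃ i x)) ≡ s̃ (suc i) (s̃ i (s̃ (suc i) x))
  s̃-braid {i} {x} x-cells@(x-cellₛᵢ , x-cellₛₛᵢ) = begin
    s̃ i b                          ≡⟨ s̃-degenerate (b-cellᵢ , b-cellₛᵢ) ⟩
    b                              ≡⟨ cong (λ t → s̃ (suc i) (s̃ i t)) (sym (s̃-degenerate x-cells)) ⟩
    s̃ (suc i) (s̃ i (s̃ (suc i) x))  ∎
    where
    i≢ssi : i ≢ suc (suc i)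
    i≢ssi = <⇒≢ (n≤1+n (suc i))
    a : Carrier
    a = s̃ i x
    a-cellᵢ : Cell i a
    a-cellᵢ = s̃-cell i x x-cellₛᵢ
    a-cellₛₛᵢ : Cell (suc (suc i)) a
    a-cellₛₛᵢ = Cell-s̃ (≢-sym i≢ssi) 1+n≢n x-cellₛᵢ x-cellₛₛᵢ
    b : Carrier
    b = s̃ (suc i) a
    b-cellₛᵢ : Cell (suc i) b
    b-cellₛᵢ = s̃-cell (suc i) a a-cellₛₛᵢ
    b-cellᵢ : Cell i b
    b-cellᵢ = Cell-s̃ (≢-sym 1+n≢n) i≢ssi a-cellₛₛᵢ a-cellᵢ

lemma2p2p11 : (𝒮 : CubicalωCat) → let open CubicalωCat 𝒮 in
    (i j : ℕ) (α : Sign) →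
    ( (∀ x → Cell (suc j) x →
         (i ≡ j → δ i α (s̃ j x) ≡ s̃ j (δ (suc j) α x))
       × (i ≡ suc j → δ i α (s̃ j x) ≡ s̃ j (δ j α x))
       × (i ≢ j → i ≢ suc j → δ i α (s̃ j x) ≡ s̃ j (δ i α x)))
    × (∀ x y w → Cell (suc i) x → Cell (suc i) y → Comp j x y w →
         (j ≡ i → Comp (suc i) (s̃ i x) (s̃ i y) (s̃ i w))
       × (j ≡ suc i → Comp i (s̃ i x) (s̃ i y) (s̃ i w))
       × (j ≢ i → j ≢ suc i → Comp j (s̃ i x) (s̃ i y) (s̃ i w)))
    × (∀ x → Cell₂ i (suc i) x → s̃ i x ≡ x)
    × (Far i j →
         (∀ x → Cell₂ i (suc j) x → s i (s̃ j x) ≡ s̃ j (s i x))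
       × (∀ y → Cell₂ (suc i) j y → s̃ i (s j y) ≡ s j (s̃ i y))
       × (∀ z → Cell₂ (suc i) (suc j) z → s̃ i (s̃ j z) ≡ s̃ j (s̃ i z)))
    × (∀ x → Cell₂ (suc i) (suc (suc i)) x →
         s̃ i (s̃ (suc i) (s̃ i x)) ≡ s̃ (suc i) (s̃ i (s̃ (suc i) x))))
lemma2p2p11 𝒮 i j α =
    (λ x x-cell → (λ { refl → δ-s̃-same α x-cell })
                , (λ { refl → δ-s̃-next α x-cell })
                , (λ i≢j i≢sj → δ-s̃-other α i≢j i≢sj x-cell))
  , (λ x y w x-cell y-cell xy↦w →
        (λ { refl → s̃-comp-same x-cell y-cell xy↦w })
      , (λ { refl → s̃-comp-next x-cell y-cell xy↦w })
      , (λ j≢i j≢si → s̃-comp-other j≢i j≢si x-cell y-cell xy↦w))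
  , (λ x → s̃-degenerate)
  , (λ far → (λ x → s-s̃-comm far) , (λ y → s̃-s-comm far) , (λ z → s̃-s̃-comm far))
  , (λ x → s̃-braid)
  where open CubicalωCatProperties 𝒮
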